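{- Let $G$ be a finite simple graph, $k$ a positive integer, and $\{P_1,P_2,P_3\}$ a triangle in $\mathcal{B}_k(G)$. For $1\le i<j\le 3$ let $V_{ij}=\{v\in V(G): P_i-v=P_j-v\}$ (and $V_{31}=V_{13}$). Then exactly one of the following holds: (1) $V_{12}\cap V_{23}\cap V_{31}\neq\emptyset$, in which case the triangle is an $S$-clique; (2) the sets $V_{12},V_{23},V_{31}$ are pairwise disjoint singletons, in which case the triangle is a $T$-clique.
   Context: A stable $k$-partition of $G$ is a multiset $P=\{V_1,\dots,V_k\}$ of $k$ independent sets of $G$ (some possibly empty) partitioning $V(G)$; $P-v$ denotes $\{V_i\setminus\{v\}\}$. The Bell $k$-coloring graph $\mathcal{B}_k(G)$ has vertex set the stable $k$-partitions, with distinct $P,Q$ adjacent iff $P-v=Q-v$ for some $v\in V(G)$. An $S$-clique is a clique $\{P_1,\dots,P_m\}$ admitting an anchor vertex $u\in V(G)$ with $P_i-u=P_j-u$ for all $i<j$. A $T$-clique is a clique that is not an $S$-clique. -}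

module Defs where

open import Data.Nat using (ℕ; suc)
open import Data.Fin using (Fin; _≟_; _<_)
open import Data.Fin.Patterns using (0F; 1F; 2F)
open import Data.Fin.Permutation using (Permutation′; _⟨$⟩ʳ_)
open import Data.Bool using (Bool; true; false; _∧_; not)
open import Data.Product using (Σ; ∃; ∃-syntax; _×_; _,_)
open import Data.Sum using (_⊎_)
open import Relation.Binary.PropositionalEquality using (_≡_; _≢_)
open import Relation.Nullary using (¬_)
open import Relation.Nullary.Decidable using (⌊_⌋)

record Graph (n : ℕ) : Set where
  field
    adj   : Fin n → Fin n → Bool
    sym   : ∀ u v → adj u v ≡ adj v u
    loopless : ∀ v → adj v v ≡ false
open Graph public

-- An indexed family of k subsets of Fin n (a subset is a Bool-valued
-- characteristic function); read up to reindexing it is a multiset of sets.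
Family : ℕ → ℕ → Set
Family n k = Fin k → Fin n → Bool

_≈ₘ_ : ∀ {n k} → Family n k → Family n k → Set
_≈ₘ_ {k = k} A B = Σ (Permutation′ k) λ σ → (∀ i w → A i w ≡ B (σ ⟨$⟩ʳ i) w)

_─_ : ∀ {n k} → Family n k → Fin n → Family n k
(A ─ v) i w = A i w ∧ not ⌊ w ≟ v ⌋

record StablePartition {n : ℕ} (G : Graph n) (k : ℕ) : Set where
  field
    parts       : Family n k
    covers      : ∀ v → ∃[ i ] parts i v ≡ true
    disjoint    : ∀ v i j → parts i v ≡ true → parts j v ≡ true → i ≡ j
    independent : ∀ i u w → parts i u ≡ true → parts i w ≡ true → adj G u w ≡ false
open StablePartition public

module _ {n k : ℕ} {G : Graph n} where

  _≈ₚ_ : StablePartition G k → StablePartition G k → Set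
  P ≈ₚ Q = parts P ≈ₘ parts Q

  SameOff : Fin n → StablePartition G k → StablePartition G k → Set
  SameOff v P Q = (parts P ─ v) ≈ₘ (parts Q ─ v)

  BellAdj : StablePartition G k → StablePartition G k → Set
  BellAdj P Q = ¬ (P ≈ₚ Q) × ∃[ v ] SameOff v P Q

  IsClique : ∀ {m} → (Fin m → StablePartition G k) → Set
  IsClique P = ∀ i j → i ≢ j → BellAdj (P i) (P j)

  SClique : ∀ {m} → (Fin m → StablePartition G k) → Set
  SClique P = IsClique P × ∃[ u ] (∀ i j → i < j → SameOff u (P i) (P j))

  TClique : ∀ {m} → (Fin m → StablePartition G k) → Set
  TClique P = IsClique P × ¬ SClique P

  -- For a triangle {P_1,P_2,P_3} (indexed by Fin 3 as 0,1,2):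
  -- V_ij = { v : P_i - v = P_j - v }
  V : (Fin 3 → StablePartition G k) → Fin 3 → Fin 3 → Fin n → Set
  V P i j v = SameOff v (P i) (P j)

  CommonVertex : (Fin 3 → StablePartition G k) → Set
  CommonVertex P = ∃[ v ] (V P 0F 1F v × V P 1F 2F v × V P 0F 2F v)

  IsSingleton : (Fin n → Set) → Fin n → Set
  IsSingleton A a = ∀ v → (A v → v ≡ a) × (v ≡ a → A v)

  DisjointSingletons : (Fin 3 → StablePartition G k) → Set
  DisjointSingletons P = ∃[ a ] ∃[ b ] ∃[ c ]
    ( IsSingleton (V P 0F 1F) a × IsSingleton (V P 1F 2F) b
    × IsSingleton (V P 0F 2F) c × a ≢ b × b ≢ c × a ≢ c )

{-# OPTIONS --safe #-}
-- Write V_PQ for the set of v with P - v = Q - v; in a triangle each V_PQ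
-- is nonempty, and V_PQ ∩ V_QR ⊆ V_PR since P - v = Q - v is an
-- equivalence.  Rigidity: if P - a = Q - a and the block of a is the same
-- in P and Q, then P = Q.  So if V_PQ held a second vertex a′, P and Q would
-- disagree on whether a and a′ share a block; but when a and a′ are both
-- outside V_QR and V_PR, both P and Q agree with R on that question.  Hence
-- either some chosen witness lies in all three sets, or each V_PQ is the
-- singleton of its witness; the anchor of an S-clique would lie in all three.
module Submission where

open import Defs hiding (sym)
open import Data.Nat using (ℕ; _≥_; z≤n; s≤s)
open import Data.Fin using (Fin; _≟_; _<_)
open import Data.Fin.Patterns using (0F; 1F; 2F)
open import Data.Fin.Permutation using (Permutation′; _⟨$⟩ʳ_; _⟨$⟩ˡ_; inverseʳ; flip; _∘ₚ_; transpose)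
import Data.Fin.Permutation.Components as PC
open import Data.Fin.Properties using (all?)
open import Data.Bool using (Bool; true)
open import Data.Bool.Properties using (¬-not; ∧-identityʳ; ∧-zeroʳ)
import Data.Bool.Properties as Bool
open import Data.Empty using (⊥-elim)
open import Data.Product using (_×_; _,_; proj₁; proj₂)
open import Data.Sum using (_⊎_; inj₁; inj₂)
import Data.Sum as Sum
open import Function using (_∘_)
open import Function.Bundles using (Injection)
open import Function.Properties.Inverse using (↔⇒↣)
open import Relation.Nullary using (¬_; Dec; yes; no; ¬?; _→-dec_; map′; decidable-stable)
open import Relation.Binary.PropositionalEquality

private
  variable
    n k : ℕ

module _ {m : ℕ} where

  transpose-matchˡ : (i j : Fin m) → PC.transpose i j i ≡ j
  transpose-matchˡ i j with i ≟ i
  ... | yes _   = refl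
  ... | no i≢i = ⊥-elim (i≢i refl)

  transpose-invariant : ∀ {a} {A : Set a} (f : Fin m → A) {i j : Fin m} →
                        f i ≡ f j → ∀ x → f (PC.transpose i j x) ≡ f x
  transpose-invariant f {i} {j} fi≡fj x with x ≟ i
  ... | yes refl = sym fi≡fj
  ... | no _ with x ≟ j
  ...   | yes refl = fi≡fj
  ...   | no _     = refl

  ⟨$⟩ʳ-injective : (π : Permutation′ m) {i j : Fin m} → π ⟨$⟩ʳ i ≡ π ⟨$⟩ʳ j → i ≡ j
  ⟨$⟩ʳ-injective π = Injection.injective (↔⇒↣ π)

≈ₘ-sym : {A B : Family n k} → A ≈ₘ B → B ≈ₘ A
≈ₘ-sym {B = B} (σ , A≡Bσ) = flip σ , λ i w →
  trans (cong (λ j → B j w) (sym (inverseʳ σ))) (sym (A≡Bσ (σ ⟨$⟩ˡ i) w))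

≈ₘ-trans : {A B C : Family n k} → A ≈ₘ B → B ≈ₘ C → A ≈ₘ C
≈ₘ-trans (σ , A≡Bσ) (τ , B≡Cτ) = σ ∘ₚ τ , λ i w → trans (A≡Bσ i w) (B≡Cτ (σ ⟨$⟩ʳ i) w)

─-≢ : ∀ {A : Family n k} {v w} i → w ≢ v → (A ─ v) i w ≡ A i w
─-≢ {v = v} {w} i w≢v with w ≟ v
... | yes w≡v = ⊥-elim (w≢v w≡v)
... | no _    = ∧-identityʳ _

─-agree : ∀ {A B : Family n k} {v} {i j} w → (w ≢ v → A i w ≡ B j w) → (A ─ v) i w ≡ (B ─ v) j w
─-agree {v = v} w agree with w ≟ v
... | yes _   = trans (∧-zeroʳ _) (sym (∧-zeroʳ _))
... | no w≢v = trans (∧-identityʳ _) (trans (agree w≢v) (sym (∧-identityʳ _)))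

InOnlyPart : Family n k → Fin k → Fin n → Set
InOnlyPart A i w = A i w ≡ true × (∀ j → A j w ≡ true → j ≡ i)

InOnlyPart-─ : ∀ {A : Family n k} {i v w} → w ≢ v → InOnlyPart A i w → InOnlyPart (A ─ v) i w
InOnlyPart-─ {A = A} {i} w≢v (w∈Aᵢ , unique) =
  trans (─-≢ {A = A} i w≢v) w∈Aᵢ , λ j w∈Aⱼ → unique j (trans (sym (─-≢ {A = A} j w≢v)) w∈Aⱼ)

module _ {A B : Family n k} {b : Fin n} {i₀ j₀ : Fin k} where

  column-agree : InOnlyPart A i₀ b → InOnlyPart B j₀ b →
                 (σ : Permutation′ k) → σ ⟨$⟩ʳ i₀ ≡ j₀ → ∀ i → A i b ≡ B (σ ⟨$⟩ʳ i) b
  column-agree (b∈A , A-unique) (b∈B , B-unique) σ σi₀≡j₀ i with i ≟ i₀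
  ... | yes refl = trans b∈A (sym (subst (λ j → B j b ≡ true) (sym σi₀≡j₀) b∈B))
  ... | no i≢i₀ = trans (¬-not (i≢i₀ ∘ A-unique i)) (sym (¬-not σi≢j₀))
    where
    σi≢j₀ : B (σ ⟨$⟩ʳ i) b ≢ true
    σi≢j₀ b∈Bσi = i≢i₀ (⟨$⟩ʳ-injective σ (trans (B-unique _ b∈Bσi) (sym σi₀≡j₀)))

  -- τ matches A with B away from b; swapping τ i₀ with j₀ repairs the
  -- match at b and costs nothing elsewhere, where B (τ i₀) and B j₀ agree.
  ≈ₘ-glue : InOnlyPart A i₀ b → InOnlyPart B j₀ b →
            (τ : Permutation′ k) → (∀ i w → w ≢ b → A i w ≡ B (τ ⟨$⟩ʳ i) w) →
            (∀ w → w ≢ b → A i₀ w ≡ B j₀ w) → A ≈ₘ B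
  ≈ₘ-glue b∈A b∈B τ A≡Bτ A₀≡B₀ = σ , agree
    where
    σ : Permutation′ k
    σ = τ ∘ₚ transpose (τ ⟨$⟩ʳ i₀) j₀

    agree : ∀ i w → A i w ≡ B (σ ⟨$⟩ʳ i) w
    agree i w with w ≟ b
    ... | yes refl = column-agree b∈A b∈B σ (transpose-matchˡ (τ ⟨$⟩ʳ i₀) j₀) i
    ... | no w≢b  = trans (A≡Bτ i w w≢b)
                      (sym (transpose-invariant (λ j → B j w)
                             (trans (sym (A≡Bτ i₀ w w≢b)) (A₀≡B₀ w w≢b)) (τ ⟨$⟩ʳ i)))

module _ {n k : ℕ} {G : Graph n} where

  private
    SP = StablePartition G k

  block : SP → Fin n → Fin k
  block P x = proj₁ (covers P x)

  InOnlyPart-block : (P : SP) (x : Fin n) → InOnlyPart (parts P) (block P x) x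
  InOnlyPart-block P x = proj₂ (covers P x) , λ i x∈Pᵢ → disjoint P x i (block P x) x∈Pᵢ (proj₂ (covers P x))

  sameBlock : SP → Fin n → Fin n → Bool
  sameBlock P x = parts P (block P x)

  sameOff-sym : (P Q : SP) {v : Fin n} → SameOff v P Q → SameOff v Q P
  sameOff-sym P Q {v} = ≈ₘ-sym {A = parts P ─ v} {parts Q ─ v}

  sameOff-trans : (P Q R : SP) {v : Fin n} → SameOff v P Q → SameOff v Q R → SameOff v P R
  sameOff-trans P Q R {v} = ≈ₘ-trans {A = parts P ─ v} {parts Q ─ v} {parts R ─ v}

  module _ (P Q : SP) where

    sameOff-parts : ∀ {v} ((σ , _) : SameOff v P Q) → ∀ i w → w ≢ v → parts P i w ≡ parts Q (σ ⟨$⟩ʳ i) w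
    sameOff-parts (σ , P─v≡Q─vσ) i w w≢v =
      trans (sym (─-≢ {A = parts P} i w≢v)) (trans (P─v≡Q─vσ i w) (─-≢ {A = parts Q} (σ ⟨$⟩ʳ i) w≢v))

    sameOff-block : ∀ {v} ((σ , _) : SameOff v P Q) → ∀ {x} → x ≢ v → block Q x ≡ σ ⟨$⟩ʳ block P x
    sameOff-block v∈V {x} x≢v = sym (proj₂ (InOnlyPart-block Q x) _
      (trans (sym (sameOff-parts v∈V (block P x) x x≢v)) (proj₁ (InOnlyPart-block P x))))

    sameOff-sameBlock : ∀ {v} → SameOff v P Q → ∀ {x y} → x ≢ v → y ≢ v → sameBlock P x y ≡ sameBlock Q x y
    sameOff-sameBlock v∈V {x} {y} x≢v y≢v =
      trans (sameOff-parts v∈V (block P x) y y≢v) (cong (λ j → parts Q j y) (sym (sameOff-block v∈V x≢v)))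

    ≈ₚ-glue : ∀ {a} → SameOff a P Q → (∀ y → y ≢ a → sameBlock P a y ≡ sameBlock Q a y) → P ≈ₚ Q
    ≈ₚ-glue {a} a∈V agree =
      ≈ₘ-glue {A = parts P} {parts Q} (InOnlyPart-block P a) (InOnlyPart-block Q a)
        (proj₁ a∈V) (sameOff-parts a∈V) agree

    sameOff-glue : ∀ {a b} → SameOff b P Q → b ≢ a →
                   (∀ y → y ≢ b → y ≢ a → sameBlock P b y ≡ sameBlock Q b y) → SameOff a P Q
    sameOff-glue {a} {b} b∈V b≢a agree =
      ≈ₘ-glue {A = parts P ─ a} {parts Q ─ a}
        (InOnlyPart-─ {A = parts P} b≢a (InOnlyPart-block P b))
        (InOnlyPart-─ {A = parts Q} b≢a (InOnlyPart-block Q b))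
        (proj₁ b∈V)
        (λ i w w≢b → ─-agree {A = parts P} {parts Q} w λ _ → sameOff-parts b∈V i w w≢b)
        (λ y y≢b → ─-agree {A = parts P} {parts Q} y (agree y y≢b))

    -- A known witness b is what makes this decidable: relative to it,
    -- P - a = Q - a only asks whether the block of b agrees off {a, b}.
    sameOff? : ∀ {b} → SameOff b P Q → ∀ a → Dec (SameOff a P Q)
    sameOff? {b} b∈V a with a ≟ b
    ... | yes refl = yes b∈V
    ... | no a≢b  = map′ (sameOff-glue b∈V (a≢b ∘ sym))
                         (λ a∈V y _ y≢a → sameOff-sameBlock a∈V (a≢b ∘ sym) y≢a)
                         (all? λ y → ¬? (y ≟ b) →-dec ¬? (y ≟ a) →-dec (sameBlock P b y Bool.≟ sameBlock Q b y))

    ≈ₚ-from-two-witnesses : ∀ {a a′} → SameOff a P Q → SameOff a′ P Q → a′ ≢ a →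
                            sameBlock P a a′ ≡ sameBlock Q a a′ → P ≈ₚ Q
    ≈ₚ-from-two-witnesses {a} {a′} a∈V a′∈V a′≢a eq = ≈ₚ-glue a∈V agree
      where
      agree : ∀ y → y ≢ a → sameBlock P a y ≡ sameBlock Q a y
      agree y _ with y ≟ a′
      ... | yes refl = eq
      ... | no y≢a′  = sameOff-sameBlock a′∈V (a′≢a ∘ sym) y≢a′

  sameOff-unique : (P Q R : SP) {a b c : Fin n} → ¬ P ≈ₚ Q →
                   SameOff a P Q → SameOff b Q R → SameOff c P R →
                   ¬ SameOff b P Q → ¬ SameOff c P Q → ∀ {a′} → SameOff a′ P Q → a′ ≡ a
  sameOff-unique P Q R {a} {b} {c} P≉Q a∈PQ b∈QR c∈PR b∉PQ c∉PQ {a′} a′∈PQ =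
    decidable-stable (a′ ≟ a) λ a′≢a → P≉Q (≈ₚ-from-two-witnesses P Q a∈PQ a′∈PQ a′≢a (begin
      sameBlock P a a′  ≡⟨ sameOff-sameBlock P R c∈PR (≢c a∈PQ) (≢c a′∈PQ) ⟩
      sameBlock R a a′  ≡⟨ sameOff-sameBlock Q R b∈QR (≢b a∈PQ) (≢b a′∈PQ) ⟨
      sameBlock Q a a′  ∎))
    where
    open ≡-Reasoning
    ≢b : ∀ {x} → SameOff x P Q → x ≢ b
    ≢b x∈PQ refl = b∉PQ x∈PQ
    ≢c : ∀ {x} → SameOff x P Q → x ≢ c
    ≢c x∈PQ refl = c∉PQ x∈PQ

  singleton : {A : Fin n → Set} {a : Fin n} → A a → (∀ {v} → A v → v ≡ a) → IsSingleton {k = k} {G = G} A a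
  singleton a∈A unique v = unique , λ { refl → a∈A }

  commonVertex-or-disjointSingletons : (T : Fin 3 → SP) → IsClique T → CommonVertex T ⊎ DisjointSingletons T
  commonVertex-or-disjointSingletons T clique =
    dichotomy (clique 0F 1F λ ()) (clique 1F 2F λ ()) (clique 0F 2F λ ())
    where
    P = T 0F
    Q = T 1F
    R = T 2F
    dichotomy : BellAdj P Q → BellAdj Q R → BellAdj P R → CommonVertex T ⊎ DisjointSingletons T
    dichotomy (P≉Q , a , a∈PQ) (Q≉R , b , b∈QR) (P≉R , c , c∈PR)
      with sameOff? Q R b∈QR a | sameOff? P R c∈PR b | sameOff? P Q a∈PQ c
    ... | yes a∈QR | _ | _ = inj₁ (a , a∈PQ , a∈QR , sameOff-trans P Q R a∈PQ a∈QR)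
    ... | no _ | yes b∈PR | _ = inj₁ (b , sameOff-trans P R Q b∈PR (sameOff-sym Q R b∈QR) , b∈QR , b∈PR)
    ... | no _ | no _ | yes c∈PQ = inj₁ (c , c∈PQ , sameOff-trans Q P R (sameOff-sym P Q c∈PQ) c∈PR , c∈PR)
    ... | no a∉QR | no b∉PR | no c∉PQ = inj₂
      ( a , b , c
      , singleton a∈PQ (sameOff-unique P Q R P≉Q a∈PQ b∈QR c∈PR b∉PQ c∉PQ)
      , singleton b∈QR (sameOff-unique Q R P Q≉R b∈QR (sameOff-sym P R c∈PR) (sameOff-sym P Q a∈PQ) c∉QR a∉QR)
      , singleton c∈PR (sameOff-unique P R Q P≉R c∈PR (sameOff-sym Q R b∈QR) a∈PQ b∉PR a∉PR)
      , (λ { refl → b∉PQ a∈PQ }) , (λ { refl → c∉QR b∈QR }) , (λ { refl → c∉PQ a∈PQ }) )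
      where
      a∉PR : ¬ SameOff a P R
      a∉PR a∈PR = a∉QR (sameOff-trans Q P R (sameOff-sym P Q a∈PQ) a∈PR)
      b∉PQ : ¬ SameOff b P Q
      b∉PQ b∈PQ = b∉PR (sameOff-trans P Q R b∈PQ b∈QR)
      c∉QR : ¬ SameOff c Q R
      c∉QR c∈QR = c∉PQ (sameOff-trans P R Q c∈PR (sameOff-sym Q R c∈QR))

  commonVertex⇒¬disjointSingletons : (T : Fin 3 → SP) → CommonVertex T → ¬ DisjointSingletons T
  commonVertex⇒¬disjointSingletons T (v , v∈V₀₁ , v∈V₁₂ , _) (_ , _ , _ , V₀₁≡a , V₁₂≡b , _ , a≢b , _) =
    a≢b (trans (sym (proj₁ (V₀₁≡a v) v∈V₀₁)) (proj₁ (V₁₂≡b v) v∈V₁₂))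

  sClique⇒commonVertex : (T : Fin 3 → SP) → SClique T → CommonVertex T
  sClique⇒commonVertex T (_ , u , anchor) =
    u , anchor 0F 1F (s≤s z≤n) , anchor 1F 2F (s≤s (s≤s z≤n)) , anchor 0F 2F (s≤s z≤n)

  commonVertex⇒sClique : (T : Fin 3 → SP) → IsClique T → CommonVertex T → SClique T
  commonVertex⇒sClique T clique (v , v∈V₀₁ , v∈V₁₂ , v∈V₀₂) = clique , v , anchor
    where
    anchor : ∀ i j → i < j → SameOff v (T i) (T j)
    anchor 0F 1F _ = v∈V₀₁
    anchor 0F 2F _ = v∈V₀₂
    anchor 1F 2F _ = v∈V₁₂
    anchor _  0F ()
    anchor 1F 1F (s≤s ())
    anchor 2F 1F (s≤s ())
    anchor 2F 2F (s≤s (s≤s ()))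

lemma3p3 : (n : ℕ) (G : Graph n) (k : ℕ) → k ≥ 1 →
    (P : Fin 3 → StablePartition G k) → IsClique P →
    ((CommonVertex P × SClique P) ⊎ (DisjointSingletons P × TClique P))
    × ¬ (CommonVertex P × DisjointSingletons P)
lemma3p3 n G k _ P clique =
  Sum.map (λ common → common , commonVertex⇒sClique P clique common)
          (λ single → single , clique , λ sClique →
             commonVertex⇒¬disjointSingletons P (sClique⇒commonVertex P sClique) single)
          (commonVertex-or-disjointSingletons P clique)
  , λ (common , single) → commonVertex⇒¬disjointSingletons P common single
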